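{- For any relational structure $\mathbf{A}$, $\overline{hw}(\mathbf{A})=\overline{ghw}(\mathbf{A})$.
   Context: Relational structures and homomorphisms are as usual; $\mathbf{A}\equiv\mathbf{A}'$ (semantic equivalence) means there are homomorphisms in both directions. The hypergraph $H(\mathbf{A})$ has the domain of $\mathbf{A}$ as vertices and, for every tuple $(a_1,\dots,a_k)$ in any relation of $\mathbf{A}$, the hyperedge $\{a_1,\dots,a_k\}$. A generalized hypertree decomposition (GHD) of a hypergraph $H$ is a rooted tree $T$ with bags $B_u\subseteq V(H)$ and covers $\lambda_u\subseteq E(H)$ such that: for each vertex $v$, $\{u: v\in B_u\}$ is connected in $T$; each hyperedge is contained in some bag; and $B_u\subseteq\bigcup\lambda_u$ for each $u$. A hypertree decomposition additionally satisfies the special condition $(\bigcup\lambda_u)\cap B(T_u)\subseteq B_u$ for each $u$, where $B(T_u)$ is the union of bags in the subtree rooted at $u$. The width of either is $\max_u|\lambda_u|$; $ghw(H)$ and $hw(H)$ are the minimum widths of GHDs and hypertree decompositions respectively. Widths of structures are those of their hypergraphs. For a width $w$, $\overline{w}(\mathbf{A})=\inf\{w(\mathbf{A}'):\mathbf{A}'\equiv\mathbf{A}\}$. -}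

module Defs where

open import Data.Nat using (ℕ; _≤_)
open import Data.Fin using (Fin)
open import Data.Vec using (Vec; []; _∷_)
import Data.Vec as Vec
open import Data.List using (List; length; concatMap; map)
import Data.List.Membership.Propositional as LM
open import Data.List.Relation.Unary.All using (All)
open import Data.List.Relation.Unary.Any using (Any)
open import Data.Fin.Subset as S using (Subset; ⁅_⁆; _∪_)
open import Data.Product using (Σ; ∃; _×_; _,_)
open import Data.Sum using (_⊎_)
open import Relation.Binary.PropositionalEquality using (_≡_)

record Signature : Set where
  field
    size  : ℕ
    arity : Fin size → ℕ
open Signature public

record Structure (σ : Signature) : Set where
  field
    dom : ℕ
    rel : (R : Fin (size σ)) → List (Vec (Fin dom) (arity σ R))
open Structure public

Hom : {σ : Signature} → Structure σ → Structure σ → Set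
Hom {σ} A B =
  Σ (Fin (dom A) → Fin (dom B)) λ f →
    ∀ (R : Fin (size σ)) (t : Vec (Fin (dom A)) (arity σ R)) →
      t LM.∈ rel A R → Vec.map f t LM.∈ rel B R

_≡ₛ_ : {σ : Signature} → Structure σ → Structure σ → Set
A ≡ₛ B = Hom A B × Hom B A

record Hypergraph : Set where
  field
    V : ℕ
    E : List (Subset V)
open Hypergraph public

tupleSet : {n k : ℕ} → Vec (Fin n) k → Subset n
tupleSet []       = S.⊥
tupleSet (a ∷ as) = ⁅ a ⁆ ∪ tupleSet as

hypergraphOf : {σ : Signature} → Structure σ → Hypergraph
hypergraphOf {σ} A = record
  { V = dom A
  ; E = concatMap (λ R → map tupleSet (rel A R)) (Data.List.allFin (size σ))
  }
  where import Data.List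

data Tree (n : ℕ) : Set where
  node : (bag : Subset n) (cover : List (Subset n)) (children : List (Tree n)) → Tree n

bagOf : {n : ℕ} → Tree n → Subset n
bagOf (node b _ _) = b

coverOf : {n : ℕ} → Tree n → List (Subset n)
coverOf (node _ c _) = c

data Pos {n : ℕ} : Tree n → Set where
  here  : {b : Subset n} {c : List (Subset n)} {cs : List (Tree n)} →
          Pos (node b c cs)
  there : {b : Subset n} {c : List (Subset n)} {cs : List (Tree n)} {t : Tree n} →
          t LM.∈ cs → Pos t → Pos (node b c cs)

subtree : {n : ℕ} {t : Tree n} → Pos t → Tree n
subtree {t = t} here = t
subtree (there _ p) = subtree p

bagAt : {n : ℕ} {t : Tree n} → Pos t → Subset n
bagAt p = bagOf (subtree p)

coverAt : {n : ℕ} {t : Tree n} → Pos t → List (Subset n)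
coverAt p = coverOf (subtree p)

data Child {n : ℕ} : {t : Tree n} → Pos t → Pos t → Set where
  top    : {b b' : Subset n} {c c' : List (Subset n)} {cs cs' : List (Tree n)}
           (m : node b' c' cs' LM.∈ cs) → Child {t = node b c cs} here (there m here)
  deeper : {b : Subset n} {c : List (Subset n)} {cs : List (Tree n)} {t : Tree n}
           (m : t LM.∈ cs) {p q : Pos t} → Child p q →
           Child {t = node b c cs} (there m p) (there m q)

Adjacent : {n : ℕ} {t : Tree n} → Pos t → Pos t → Set
Adjacent p q = Child p q ⊎ Child q p

data Walk {n : ℕ} {t : Tree n} (S : Pos t → Set) : Pos t → Pos t → Set where
  stay : {p : Pos t} → S p → Walk S p p
  step : {p q r : Pos t} → S p → Adjacent p q → Walk S q r → Walk S p r

Connected : {n : ℕ} {t : Tree n} → (Pos t → Set) → Set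
Connected {t = t} S = (p q : Pos t) → S p → S q → Walk S p q

record IsGHD (H : Hypergraph) (T : Tree (V H)) : Set where
  field
    connectedness : (v : Fin (V H)) → Connected (λ (p : Pos T) → v S.∈ bagAt p)
    edgesCovered  : (e : Subset (V H)) → e LM.∈ E H → ∃ λ (p : Pos T) → e S.⊆ bagAt p
    coverEdges    : (p : Pos T) → All (LM._∈ E H) (coverAt p)
    bagInCover    : (p : Pos T) (v : Fin (V H)) → v S.∈ bagAt p →
                    Any (v S.∈_) (coverAt p)

InSubtreeBags : {n : ℕ} {T : Tree n} → Pos T → Fin n → Set
InSubtreeBags p v = ∃ λ (q : Pos (subtree p)) → v S.∈ bagAt q

record IsHD (H : Hypergraph) (T : Tree (V H)) : Set where
  field
    ghd     : IsGHD H T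
    special : (p : Pos T) (v : Fin (V H)) →
              Any (v S.∈_) (coverAt p) → InSubtreeBags p v → v S.∈ bagAt p

WidthIs : {n : ℕ} → Tree n → ℕ → Set
WidthIs T k = (∃ λ (p : Pos T) → length (coverAt p) ≡ k)
            × ((p : Pos T) → length (coverAt p) ≤ k)

IsMin : (ℕ → Set) → ℕ → Set
IsMin P k = P k × ((j : ℕ) → P j → k ≤ j)

GHW : Hypergraph → ℕ → Set
GHW H = IsMin (λ j → ∃ λ (T : Tree (V H)) → IsGHD H T × WidthIs T j)

HW : Hypergraph → ℕ → Set
HW H = IsMin (λ j → ∃ λ (T : Tree (V H)) → IsHD H T × WidthIs T j)

-- \overline{w}(A) = k, for a width notion W (W H k means "w(H) = k"):
-- k = inf { w(A') : A' ≡ A }  (an infimum of naturals is a minimum)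
SemWidth : (Hypergraph → ℕ → Set) → {σ : Signature} → Structure σ → ℕ → Set
SemWidth W {σ} A k =
  (∃ λ (A' : Structure σ) → A' ≡ₛ A × W (hypergraphOf A') k)
  × ((A' : Structure σ) → A' ≡ₛ A → (j : ℕ) → W (hypergraphOf A') j → k ≤ j)

module Submission where

-- Every GHD of a structure B becomes an HD of an equivalent structure of the same width. Give each
-- node u, for every edge of λ_u, a copy of a tuple inducing that edge in which the vertices outside
-- B_u are replaced by fresh vertices private to u, and add these copies to B. Projecting the copies
-- back is a homomorphism, so the new structure is equivalent to B. Taking the copies as the new
-- covers and their unions as the new bags yields an HD: the special condition is automatic when a
-- bag is the union of its cover, a vertex of B lies in exactly the new bags of the nodes whose old
-- bags contain it, and a fresh vertex lies in a single bag. Hence HDs and GHDs realise the same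
-- widths over the structures equivalent to A, and the two minima coincide.

open import Defs
open import Data.Nat using (ℕ; suc; _≤_; _<_; _≤?_; _*_)
open import Data.Nat.Properties using (≤-trans; <⇒≤; ≰⇒>)
open import Data.Nat.Induction using (<-rec)
open import Data.Fin as Fin using (Fin; combine; remQuot)
open import Data.Fin.Properties using (remQuot-combine; combine-remQuot; combine-injective; suc-injective)
open import Data.Fin.Subset as S using (Subset; ⋃; ⁅_⁆)
open import Data.Fin.Subset.Properties using (_∈?_; x∈p∪q⁺; x∈p∪q⁻; x∈⁅x⁆; x∈⁅y⁆⇒x≡y; ∉⊥)
open import Data.Vec as Vec using (Vec; []; _∷_)
open import Data.Vec.Properties using (map-∘; map-cong; map-id)
open import Data.Vec.Membership.Propositional using () renaming (_∈_ to _∈ᵥ_)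
import Data.Vec.Membership.Propositional.Properties as VecMembershipₚ
open import Data.Vec.Relation.Unary.Any as VecAny using ()
open import Data.List as List using (List; []; _∷_; length; map; concatMap; _++_; allFin)
open import Data.List.Properties using (length-map)
open import Data.List.Membership.Propositional using (_∈_; find; lose; mapWith∈)
open import Data.List.Membership.Propositional.Properties
  using (∈-map⁺; ∈-map⁻; ∈-++⁺ˡ; ∈-++⁺ʳ; ∈-++⁻; ∈-concatMap⁺; ∈-concatMap⁻; ∈-allFin)
open import Data.List.Membership.Setoid.Properties using (index-injective; length-mapWith∈)
open import Data.List.Relation.Unary.All as All using (All)
open import Data.List.Relation.Unary.Any as Any using (Any; here; there)
open import Data.List.Relation.Unary.Any.Properties using (mapWith∈⁺; map⁻)
open import Data.Product using (Σ; ∃; ∃₂; _×_; _,_; proj₁; proj₂; uncurry)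
open import Data.Sum using (_⊎_; inj₁; inj₂; [_,_]′)
open import Data.Empty using (⊥-elim)
open import Function using (_∘_)
open import Function.Bundles using (_⇔_; mk⇔; Equivalence)
import Function.Properties.Equivalence as ⇔
open import Relation.Binary.Definitions using (DecidableEquality)
open import Relation.Nullary using (yes; no; contradiction)
open import Relation.Binary.PropositionalEquality

∈-⋃⁺ : {n : ℕ} {x : Fin n} {es : List (Subset n)} → Any (x S.∈_) es → x S.∈ ⋃ es
∈-⋃⁺ (here x∈e)   = x∈p∪q⁺ (inj₁ x∈e)
∈-⋃⁺ (there x∈es) = x∈p∪q⁺ (inj₂ (∈-⋃⁺ x∈es))

∈-⋃⁻ : {n : ℕ} {x : Fin n} (es : List (Subset n)) → x S.∈ ⋃ es → Any (x S.∈_) es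
∈-⋃⁻ []       x∈⋃ = ⊥-elim (∉⊥ x∈⋃)
∈-⋃⁻ (e ∷ es) x∈⋃ with x∈p∪q⁻ e (⋃ es) x∈⋃
... | inj₁ x∈e  = here x∈e
... | inj₂ x∈es = there (∈-⋃⁻ es x∈es)

module _ {n : ℕ} where

  ∈-tupleSet⁺ : {k : ℕ} {x : Fin n} {t : Vec (Fin n) k} → x ∈ᵥ t → x S.∈ tupleSet t
  ∈-tupleSet⁺ (VecAny.here refl) = x∈p∪q⁺ (inj₁ (x∈⁅x⁆ _))
  ∈-tupleSet⁺ (VecAny.there x∈t) = x∈p∪q⁺ (inj₂ (∈-tupleSet⁺ x∈t))

  ∈-tupleSet⁻ : {k : ℕ} {x : Fin n} (t : Vec (Fin n) k) → x S.∈ tupleSet t → x ∈ᵥ t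
  ∈-tupleSet⁻ []      x∈t = ⊥-elim (∉⊥ x∈t)
  ∈-tupleSet⁻ (a ∷ t) x∈t with x∈p∪q⁻ ⁅ a ⁆ (tupleSet t) x∈t
  ... | inj₁ x∈a = VecAny.here (x∈⁅y⁆⇒x≡y a x∈a)
  ... | inj₂ x∈t = VecAny.there (∈-tupleSet⁻ t x∈t)

  ∈-tupleSet-map⁻ : {m k : ℕ} {y : Fin n} (f : Fin m → Fin n) (t : Vec (Fin m) k) →
                    y S.∈ tupleSet (Vec.map f t) → ∃ λ x → x ∈ᵥ t × y ≡ f x
  ∈-tupleSet-map⁻ f []      y∈ = ⊥-elim (∉⊥ y∈)
  ∈-tupleSet-map⁻ f (x ∷ t) y∈ with x∈p∪q⁻ ⁅ f x ⁆ (tupleSet (Vec.map f t)) y∈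
  ... | inj₁ y∈fx = x , VecAny.here refl , x∈⁅y⁆⇒x≡y (f x) y∈fx
  ... | inj₂ y∈ft with ∈-tupleSet-map⁻ f t y∈ft
  ...   | x' , x'∈t , y≡fx' = x' , VecAny.there x'∈t , y≡fx'

map-leftInverse : {A B : Set} {k : ℕ} {f : A → B} {g : B → A} →
                  (∀ x → g (f x) ≡ x) → (t : Vec A k) → Vec.map g (Vec.map f t) ≡ t
map-leftInverse {f = f} {g} g∘f≗id t = begin
  Vec.map g (Vec.map f t) ≡⟨ map-∘ g f t ⟨
  Vec.map (g ∘ f) t       ≡⟨ map-cong g∘f≗id t ⟩
  Vec.map (λ x → x) t     ≡⟨ map-id t ⟩
  t                       ∎
  where open ≡-Reasoning

module _ {I : Set} (_≟_ : DecidableEquality I) {P : I → Set} where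

  fibre : (i : I) → List (Σ I P) → List (P i)
  fibre i [] = []
  fibre i ((j , x) ∷ xs) with j ≟ i
  ... | yes refl = x ∷ fibre i xs
  ... | no _     = fibre i xs

  ∈-fibre⁺ : {i : I} {x : P i} {xs : List (Σ I P)} → (i , x) ∈ xs → x ∈ fibre i xs
  ∈-fibre⁺ {i} {xs = (j , y) ∷ xs} (here refl) with i ≟ i
  ... | yes refl = here refl
  ... | no i≢i   = contradiction refl i≢i
  ∈-fibre⁺ {i} {xs = (j , y) ∷ xs} (there ix∈xs) with j ≟ i
  ... | yes refl = there (∈-fibre⁺ ix∈xs)
  ... | no _     = ∈-fibre⁺ ix∈xs

  ∈-fibre⁻ : {i : I} {x : P i} (xs : List (Σ I P)) → x ∈ fibre i xs → (i , x) ∈ xs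
  ∈-fibre⁻ {i} ((j , y) ∷ xs) x∈ with j ≟ i
  ∈-fibre⁻ {i} ((j , y) ∷ xs) (here x≡y) | yes refl = here (cong (i ,_) x≡y)
  ∈-fibre⁻ {i} ((j , y) ∷ xs) (there x∈) | yes refl = there (∈-fibre⁻ xs x∈)
  ... | no _ = there (∈-fibre⁻ xs x∈)

module _ {P : ℕ → Set} {k : ℕ} where

  ≤-minima⇒≤ : (∀ m → IsMin P m → k ≤ m) → ∀ j → P j → k ≤ j
  ≤-minima⇒≤ k≤minima = <-rec (λ j → P j → k ≤ j) below
    where
    -- If k ≰ j, then induction makes j itself a minimum of P, and k ≤ j after all.
    below : ∀ j → (∀ {i} → i < j → P i → k ≤ i) → P j → k ≤ j
    below j ih Pj with k ≤? j
    ... | yes k≤j = k≤j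
    ... | no  k≰j = contradiction (k≤minima j (Pj , j≤P)) k≰j
      where
      j≤P : ∀ i → P i → j ≤ i
      j≤P i Pi with j ≤? i
      ... | yes j≤i = j≤i
      ... | no  j≰i = contradiction (≤-trans (ih (≰⇒> j≰i) Pi) (<⇒≤ (≰⇒> j≰i))) k≰j

IsMin-⇔ : {P Q : ℕ → Set} {k : ℕ} → (∀ j → P j ⇔ Q j) → IsMin P k ⇔ IsMin Q k
IsMin-⇔ P⇔Q = mk⇔ (transport P⇔Q) (transport (⇔.sym ∘ P⇔Q))
  where
  transport : ∀ {P Q k} → (∀ j → P j ⇔ Q j) → IsMin P k → IsMin Q k
  transport P⇔Q (Pk , k≤P) = Equivalence.to (P⇔Q _) Pk , λ j → k≤P j ∘ Equivalence.from (P⇔Q j)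

module _ {σ : Signature} where

  Hom-∘ : {A B C : Structure σ} → Hom B C → Hom A B → Hom A C
  Hom-∘ {C = C} (g , g-hom) (f , f-hom) =
    g ∘ f , λ R t t∈A → subst (_∈ rel C R) (sym (map-∘ g f t)) (g-hom R _ (f-hom R t t∈A))

  ≡ₛ-trans : {A B C : Structure σ} → A ≡ₛ B → B ≡ₛ C → A ≡ₛ C
  ≡ₛ-trans (A→B , B→A) (B→C , C→B) = Hom-∘ B→C A→B , Hom-∘ B→A C→B

  Fact : Structure σ → Set
  Fact A = Σ (Fin (size σ)) λ R → Σ (Vec (Fin (dom A)) (arity σ R)) λ t → t ∈ rel A R

  tuple : {A : Structure σ} (f : Fact A) → Vec (Fin (dom A)) (arity σ (proj₁ f))
  tuple = proj₁ ∘ proj₂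

  ∈-edges⁺ : {A : Structure σ} {R : Fin (size σ)} {t : Vec (Fin (dom A)) (arity σ R)} →
             t ∈ rel A R → tupleSet t ∈ E (hypergraphOf A)
  ∈-edges⁺ {A} {R} t∈A =
    ∈-concatMap⁺ (λ R → map tupleSet (rel A R)) (lose (∈-allFin R) (∈-map⁺ tupleSet t∈A))

  ∈-edges⁻ : {A : Structure σ} {e : Subset (dom A)} → e ∈ E (hypergraphOf A) →
             Σ (Fact A) λ f → e ≡ tupleSet (tuple f)
  ∈-edges⁻ {A} e∈ with find (∈-concatMap⁻ (λ R → map tupleSet (rel A R)) {xs = allFin (size σ)} e∈)
  ... | R , _ , e∈R with ∈-map⁻ tupleSet e∈R
  ...   | t , t∈A , e≡t = (R , t , t∈A) , e≡t

module _ {n : ℕ} where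

  positions : (t : Tree n) → List (Pos t)
  positionsBelow : {X : Set} (ts : List (Tree n)) → (∀ {t} → t ∈ ts → Pos t → X) → List X
  positions (node _ _ ts) = here ∷ positionsBelow ts there
  positionsBelow []       at = []
  positionsBelow (t ∷ ts) at = map (at (here refl)) (positions t) ++ positionsBelow ts (at ∘ there)

  ∈-positions : {t : Tree n} (p : Pos t) → p ∈ positions t
  ∈-positionsBelow : {X : Set} (ts : List (Tree n)) (at : ∀ {t} → t ∈ ts → Pos t → X)
                     {t : Tree n} (t∈ts : t ∈ ts) (p : Pos t) → at t∈ts p ∈ positionsBelow ts at
  ∈-positions {node _ _ ts} here          = here refl
  ∈-positions {node _ _ ts} (there t∈ts p) = there (∈-positionsBelow ts there t∈ts p)
  ∈-positionsBelow (t ∷ ts) at (here refl) p = ∈-++⁺ˡ (∈-map⁺ (at (here refl)) (∈-positions p))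
  ∈-positionsBelow (t ∷ ts) at (there t∈ts) p =
    ∈-++⁺ʳ (map (at (here refl)) (positions t)) (∈-positionsBelow ts (at ∘ there) t∈ts p)

  Walk-map : {t : Tree n} {S S' : Pos t → Set} → (∀ p → S p → S' p) →
             {p q : Pos t} → Walk S p q → Walk S' p q
  Walk-map S⇒S' (stay Sp)          = stay (S⇒S' _ Sp)
  Walk-map S⇒S' (step Sp pq walk) = step (S⇒S' _ Sp) pq (Walk-map S⇒S' walk)

module _ {n m : ℕ} where

  relabel : (t : Tree n) → (Pos t → List (Subset m)) → Tree m
  relabelForest : (ts : List (Tree n)) → (∀ {t} → t ∈ ts → Pos t → List (Subset m)) → List (Tree m)
  relabel (node _ _ ts) f = node (⋃ (f here)) (f here) (relabelForest ts (λ t∈ts → f ∘ there t∈ts))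
  relabelForest []       g = []
  relabelForest (t ∷ ts) g = relabel t (g (here refl)) ∷ relabelForest ts (g ∘ there)

  relabel-∈ : {ts : List (Tree n)} (g : ∀ {t} → t ∈ ts → Pos t → List (Subset m)) {t : Tree n}
              (t∈ts : t ∈ ts) → relabel t (g t∈ts) ∈ relabelForest ts g
  relabel-∈ g (here refl)  = here refl
  relabel-∈ g (there t∈ts) = there (relabel-∈ (g ∘ there) t∈ts)

  relabel-pos : {t : Tree n} (f : Pos t → List (Subset m)) → Pos t → Pos (relabel t f)
  relabel-pos {node _ _ ts} f here           = here
  relabel-pos {node _ _ ts} f (there t∈ts p) =
    there (relabel-∈ (λ t∈ts → f ∘ there t∈ts) t∈ts) (relabel-pos (f ∘ there t∈ts) p)

  coverAt-relabel : {t : Tree n} (f : Pos t → List (Subset m)) (p : Pos t) →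
                    coverAt (relabel-pos f p) ≡ f p
  coverAt-relabel {node _ _ ts} f here           = refl
  coverAt-relabel {node _ _ ts} f (there t∈ts p) = coverAt-relabel (f ∘ there t∈ts) p

  bagAt-relabel : {t : Tree n} (f : Pos t → List (Subset m)) (p : Pos t) →
                  bagAt (relabel-pos f p) ≡ ⋃ (f p)
  bagAt-relabel {node _ _ ts} f here           = refl
  bagAt-relabel {node _ _ ts} f (there t∈ts p) = bagAt-relabel (f ∘ there t∈ts) p

  relabel-pos-surjective : {t : Tree n} (f : Pos t → List (Subset m)) (p' : Pos (relabel t f)) →
                           ∃ λ p → relabel-pos f p ≡ p'
  relabelForest-pos-surjective :
    (ts : List (Tree n)) (g : ∀ {t} → t ∈ ts → Pos t → List (Subset m))
    {t' : Tree m} (t'∈ : t' ∈ relabelForest ts g) (q : Pos t') →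
    ∃₂ λ t (t∈ts : t ∈ ts) → ∃ λ p →
      _≡_ {A = Σ (Tree m) λ t' → t' ∈ relabelForest ts g × Pos t'}
          (relabel t (g t∈ts) , relabel-∈ g t∈ts , relabel-pos (g t∈ts) p) (t' , t'∈ , q)
  relabel-pos-surjective {node _ _ ts} f here = here , refl
  relabel-pos-surjective {node _ _ ts} f (there t'∈ q)
    with relabelForest-pos-surjective ts (λ t∈ts → f ∘ there t∈ts) t'∈ q
  ... | t , t∈ts , p , eq = there t∈ts p , cong (λ { (_ , t'∈ , q) → there t'∈ q }) eq
  relabelForest-pos-surjective (t ∷ ts) g (here refl) q with relabel-pos-surjective (g (here refl)) q
  ... | p , refl = t , here refl , p , refl
  relabelForest-pos-surjective (t ∷ ts) g (there t'∈) q
    with relabelForest-pos-surjective ts (g ∘ there) t'∈ q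
  ... | t₀ , t∈ts , p , eq = t₀ , there t∈ts , p , cong (λ { (t' , t'∈ , q) → t' , there t'∈ , q }) eq

  relabel-child : {t : Tree n} (f : Pos t → List (Subset m)) {p q : Pos t} →
                  Child p q → Child (relabel-pos f p) (relabel-pos f q)
  relabel-child {node _ _ ts} f (top t∈ts) = top (relabel-∈ (λ t∈ts → f ∘ there t∈ts) t∈ts)
  relabel-child {node _ _ ts} f (deeper t∈ts pq) =
    deeper (relabel-∈ (λ t∈ts → f ∘ there t∈ts) t∈ts) (relabel-child (f ∘ there t∈ts) pq)

  relabel-walk : {t : Tree n} (f : Pos t → List (Subset m))
                 {S : Pos t → Set} {S' : Pos (relabel t f) → Set} →
                 (∀ p → S p → S' (relabel-pos f p)) →
                 {p q : Pos t} → Walk S p q → Walk S' (relabel-pos f p) (relabel-pos f q)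
  relabel-walk f S⇒S' (stay Sp)          = stay (S⇒S' _ Sp)
  relabel-walk f S⇒S' (step Sp pq walk) = step (S⇒S' _ Sp) (adjacent pq) (relabel-walk f S⇒S' walk)
    where
    adjacent : ∀ {p q} → Adjacent p q → Adjacent (relabel-pos f p) (relabel-pos f q)
    adjacent (inj₁ pq) = inj₁ (relabel-child f pq)
    adjacent (inj₂ qp) = inj₂ (relabel-child f qp)

module _ {n : ℕ} (H : Hypergraph) (t : Tree n) (f : Pos t → List (Subset (V H))) where

  bagAt-relabel-⋃ : (p' : Pos (relabel t f)) → bagAt p' ≡ ⋃ (coverAt p')
  bagAt-relabel-⋃ p' with relabel-pos-surjective f p'
  ... | p , refl = trans (bagAt-relabel f p) (cong ⋃ (sym (coverAt-relabel f p)))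

  relabel-isHD : (∀ v → Connected (λ p → v S.∈ ⋃ (f p))) →
                 (∀ e → e ∈ E H → ∃ λ p → e S.⊆ ⋃ (f p)) →
                 (∀ p → All (_∈ E H) (f p)) →
                 IsHD H (relabel t f)
  relabel-isHD connected covered edges = record
    { ghd = record
      { connectedness = connectedness
      ; edgesCovered  = λ e e∈ → let p , e⊆ = covered e e∈ in
                          relabel-pos f p , subst (e S.⊆_) (sym (bagAt-relabel f p)) e⊆
      ; coverEdges    = coverEdges
      ; bagInCover    = λ p' v v∈ → ∈-⋃⁻ (coverAt p') (subst (v S.∈_) (bagAt-relabel-⋃ p') v∈)
      }
    ; special = λ p' v v∈λ _ → subst (v S.∈_) (sym (bagAt-relabel-⋃ p')) (∈-⋃⁺ v∈λ)
    }
    where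
    connectedness : (v : Fin (V H)) → Connected (λ (p' : Pos (relabel t f)) → v S.∈ bagAt p')
    connectedness v p' q' v∈p' v∈q' with relabel-pos-surjective f p' | relabel-pos-surjective f q'
    ... | p , refl | q , refl =
      relabel-walk f (λ r → subst (v S.∈_) (sym (bagAt-relabel f r)))
        (connected v p q (subst (v S.∈_) (bagAt-relabel f p) v∈p')
                         (subst (v S.∈_) (bagAt-relabel f q) v∈q'))

    coverEdges : (p' : Pos (relabel t f)) → All (_∈ E H) (coverAt p')
    coverEdges p' with relabel-pos-surjective f p'
    ... | p , refl = subst (All (_∈ E H)) (sym (coverAt-relabel f p)) (edges p)

  relabel-width : {j : ℕ} → (∀ p → length (f p) ≡ length (coverAt p)) →
                  WidthIs t j → WidthIs (relabel t f) j
  relabel-width {j} same-length ((p , |p|≡j) , bounded) =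
    (relabel-pos f p , trans (|relabel| p) |p|≡j) , bounded'
    where
    |relabel| : ∀ p → length (coverAt (relabel-pos f p)) ≡ length (coverAt p)
    |relabel| p = trans (cong length (coverAt-relabel f p)) (same-length p)

    bounded' : (p' : Pos (relabel t f)) → length (coverAt p') ≤ j
    bounded' p' with relabel-pos-surjective f p'
    ... | p , refl = subst (_≤ j) (sym (|relabel| p)) (bounded p)

HasGHD : Hypergraph → ℕ → Set
HasGHD H j = ∃ λ (T : Tree (V H)) → IsGHD H T × WidthIs T j

HasHD : Hypergraph → ℕ → Set
HasHD H j = ∃ λ (T : Tree (V H)) → IsHD H T × WidthIs T j

module FreshCopies {σ : Signature} (B : Structure σ) (T : Tree (dom B)) (G : IsGHD (hypergraphOf B) T) where
  open IsGHD G

  N : ℕ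
  N = length (positions T)

  tag : Pos T → Fin N
  tag p = Any.index (∈-positions p)

  tag-injective : {p q : Pos T} → tag p ≡ tag q → p ≡ q
  tag-injective {p} {q} = index-injective (setoid (Pos T)) (∈-positions p) (∈-positions q)

  -- A vertex of the new structure is a pair (a , i) encoded by combine: i = 0 for the vertex a of B
  -- itself and i = 1 + tag p for the copy of a private to the node p.
  D : ℕ
  D = dom B * suc N

  old : Fin (dom B) → Fin D
  old a = combine a Fin.zero

  fresh : Fin (dom B) → Fin N → Fin D
  fresh a i = combine a (Fin.suc i)

  origin : Fin D → Fin (dom B)
  origin v = proj₁ (remQuot {dom B} (suc N) v)

  origin-old : ∀ a → origin (old a) ≡ a
  origin-old a = cong proj₁ (remQuot-combine a Fin.zero)

  origin-fresh : ∀ a i → origin (fresh a i) ≡ a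
  origin-fresh a i = cong proj₁ (remQuot-combine a (Fin.suc i))

  old-injective : ∀ {a b} → old a ≡ old b → a ≡ b
  old-injective {a} {b} eq = proj₁ (combine-injective a Fin.zero b Fin.zero eq)

  fresh-injectiveʳ : ∀ {a b i j} → fresh a i ≡ fresh b j → i ≡ j
  fresh-injectiveʳ {a} {b} {i} {j} eq =
    suc-injective (proj₂ (combine-injective a (Fin.suc i) b (Fin.suc j) eq))

  old≢fresh : ∀ {a b i} → old a ≢ fresh b i
  old≢fresh {a} {b} {i} eq with proj₂ (combine-injective a Fin.zero b (Fin.suc i) eq)
  ... | ()

  data VertexView : Fin D → Set where
    isOld   : ∀ a → VertexView (old a)
    isFresh : ∀ a i → VertexView (fresh a i)

  vertexView : (v : Fin D) → VertexView v
  vertexView v =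
    subst VertexView (combine-remQuot {dom B} (suc N) v) (view (remQuot {dom B} (suc N) v))
    where
    view : (ai : Fin (dom B) × Fin (suc N)) → VertexView (uncurry combine ai)
    view (a , Fin.zero)  = isOld a
    view (a , Fin.suc i) = isFresh a i

  localise : Pos T → Fin (dom B) → Fin D
  localise p a with a ∈? bagAt p
  ... | yes _ = old a
  ... | no  _ = fresh a (tag p)

  origin-localise : ∀ p a → origin (localise p a) ≡ a
  origin-localise p a with a ∈? bagAt p
  ... | yes _ = origin-old a
  ... | no  _ = origin-fresh a (tag p)

  localise-∈bag : ∀ p {a} → a S.∈ bagAt p → localise p a ≡ old a
  localise-∈bag p {a} a∈p with a ∈? bagAt p
  ... | yes _   = refl
  ... | no  a∉p = contradiction a∈p a∉p

  localise-view : ∀ p a → (a S.∈ bagAt p × localise p a ≡ old a) ⊎ localise p a ≡ fresh a (tag p)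
  localise-view p a with a ∈? bagAt p
  ... | yes a∈p = inj₁ (a∈p , refl)
  ... | no  _   = inj₂ refl

  coverFacts : Pos T → List (Fact B)
  coverFacts p =
    mapWith∈ (coverAt p) (λ e∈λ → proj₁ (∈-edges⁻ {A = B} (All.lookup (coverEdges p) e∈λ)))

  length-coverFacts : ∀ p → length (coverFacts p) ≡ length (coverAt p)
  length-coverFacts p = length-mapWith∈ (setoid (Subset (dom B))) (coverAt p)

  bag⊆coverFacts : ∀ p {a} → a S.∈ bagAt p → Any (λ f → a ∈ᵥ tuple f) (coverFacts p)
  bag⊆coverFacts p {a} a∈p with find (bagInCover p a a∈p)
  ... | e , e∈λ , a∈e = mapWith∈⁺ _ (e , e∈λ , ∈-tupleSet⁻ _ (subst (a S.∈_) e≡f a∈e))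
    where e≡f = proj₂ (∈-edges⁻ {A = B} (All.lookup (coverEdges p) e∈λ))

  Atom : Set
  Atom = Σ (Fin (size σ)) λ R → Vec (Fin D) (arity σ R)

  localiseFact : Pos T → Fact B → Atom
  localiseFact p f = proj₁ f , Vec.map (localise p) (tuple f)

  newAtoms : List Atom
  newAtoms = concatMap (λ p → map (localiseFact p) (coverFacts p)) (positions T)

  ∈-newAtoms⁺ : ∀ p {f} → f ∈ coverFacts p → localiseFact p f ∈ newAtoms
  ∈-newAtoms⁺ p f∈ = ∈-concatMap⁺ (λ p → map (localiseFact p) (coverFacts p))
                                   (lose (∈-positions p) (∈-map⁺ (localiseFact p) f∈))

  ∈-newAtoms⁻ : ∀ {x} → x ∈ newAtoms → ∃₂ λ p f → f ∈ coverFacts p × x ≡ localiseFact p f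
  ∈-newAtoms⁻ x∈
    with find (∈-concatMap⁻ (λ p → map (localiseFact p) (coverFacts p)) {xs = positions T} x∈)
  ... | p , _ , x∈p with ∈-map⁻ (localiseFact p) x∈p
  ...   | f , f∈ , x≡f = p , f , f∈ , x≡f

  withCopies : Structure σ
  withCopies = record
    { dom = D
    ; rel = λ R → map (Vec.map old) (rel B R) ++ fibre Fin._≟_ R newAtoms
    }

  old-hom : Hom B withCopies
  old-hom = old , λ R t t∈B → ∈-++⁺ˡ (∈-map⁺ (Vec.map old) t∈B)

  origin-hom : Hom withCopies B
  origin-hom = origin , origin-preserves
    where
    origin-localiseFact : ∀ p f →
                          Vec.map origin (proj₂ (localiseFact p f)) ∈ rel B (proj₁ (localiseFact p f))
    origin-localiseFact p (R , t , t∈B) =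
      subst (_∈ rel B R) (sym (map-leftInverse (origin-localise p) t)) t∈B

    origin-preserves : ∀ R s → s ∈ rel withCopies R → Vec.map origin s ∈ rel B R
    origin-preserves R s s∈ = [ fromOld , fromNew ]′ (∈-++⁻ (map (Vec.map old) (rel B R)) s∈)
      where
      fromOld : s ∈ map (Vec.map old) (rel B R) → Vec.map origin s ∈ rel B R
      fromOld s∈old =
        let t , t∈B , s≡t = ∈-map⁻ (Vec.map old) s∈old in
        subst (λ s → Vec.map origin s ∈ rel B R) (sym s≡t)
          (subst (_∈ rel B R) (sym (map-leftInverse origin-old t)) t∈B)

      fromNew : s ∈ fibre Fin._≟_ R newAtoms → Vec.map origin s ∈ rel B R
      fromNew s∈new =
        let p , f , _ , Rs≡f = ∈-newAtoms⁻ (∈-fibre⁻ Fin._≟_ newAtoms s∈new) in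
        subst (λ x → Vec.map origin (proj₂ x) ∈ rel B (proj₁ x)) (sym Rs≡f)
              (origin-localiseFact p f)

  withCopies≡ₛB : withCopies ≡ₛ B
  withCopies≡ₛB = origin-hom , old-hom

  newCover : Pos T → List (Subset D)
  newCover p = map (tupleSet ∘ proj₂ ∘ localiseFact p) (coverFacts p)

  length-newCover : ∀ p → length (newCover p) ≡ length (coverAt p)
  length-newCover p = trans (length-map _ (coverFacts p)) (length-coverFacts p)

  newCover-edges : ∀ p → All (_∈ E (hypergraphOf withCopies)) (newCover p)
  newCover-edges p = All.tabulate λ e∈ →
    let f , f∈ , e≡f = ∈-map⁻ (tupleSet ∘ proj₂ ∘ localiseFact p) e∈ in
    subst (_∈ E (hypergraphOf withCopies)) (sym e≡f)
      (∈-edges⁺ {A = withCopies} (∈-++⁺ʳ (map (Vec.map old) (rel B (proj₁ f)))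
                                        (∈-fibre⁺ Fin._≟_ (∈-newAtoms⁺ p f∈))))

  ∈-⋃newCover⁻ : ∀ p {v} → v S.∈ ⋃ (newCover p) → ∃ λ a → v ≡ localise p a
  ∈-⋃newCover⁻ p {v} v∈ =
    let f , _ , v∈f = find (map⁻ (∈-⋃⁻ (newCover p) v∈))
        a , _ , v≡a = ∈-tupleSet-map⁻ (localise p) (tuple f) v∈f
    in a , v≡a

  old∈⋃newCover⁺ : ∀ p {a} → a S.∈ bagAt p → old a S.∈ ⋃ (newCover p)
  old∈⋃newCover⁺ p {a} a∈p =
    let f , f∈ , a∈f = find (bag⊆coverFacts p a∈p)
        localised∈ = ∈-tupleSet⁺ (VecMembershipₚ.∈-map⁺ (localise p) a∈f)
    in ∈-⋃⁺ (lose (∈-map⁺ (tupleSet ∘ proj₂ ∘ localiseFact p) f∈)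
                  (subst (λ v → v S.∈ tupleSet (Vec.map (localise p) (tuple f)))
                         (localise-∈bag p a∈p) localised∈))

  old∈⋃newCover⁻ : ∀ p {a} → old a S.∈ ⋃ (newCover p) → a S.∈ bagAt p
  old∈⋃newCover⁻ p {a} a∈ =
    let b , old≡b = ∈-⋃newCover⁻ p a∈ in
    [ (λ { (b∈p , b≡old) →
           subst (λ x → x S.∈ bagAt p) (sym (old-injective (trans old≡b b≡old))) b∈p })
    , (λ b≡fresh → ⊥-elim (old≢fresh (trans old≡b b≡fresh)))
    ]′ (localise-view p b)

  fresh∈⋃newCover⁻ : ∀ p {a i} → fresh a i S.∈ ⋃ (newCover p) → tag p ≡ i
  fresh∈⋃newCover⁻ p a∈ =
    let b , fresh≡b = ∈-⋃newCover⁻ p a∈ in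
    [ (λ { (_ , b≡old) → ⊥-elim (old≢fresh (sym (trans fresh≡b b≡old))) })
    , (λ b≡fresh → sym (fresh-injectiveʳ (trans fresh≡b b≡fresh)))
    ]′ (localise-view p b)

  newCover-connected : ∀ v → Connected (λ p → v S.∈ ⋃ (newCover p))
  newCover-connected v p q v∈p v∈q = connect (vertexView v) v∈p v∈q
    where
    connect : ∀ {v} → VertexView v → v S.∈ ⋃ (newCover p) → v S.∈ ⋃ (newCover q) →
              Walk (λ r → v S.∈ ⋃ (newCover r)) p q
    connect (isOld a) a∈p a∈q =
      Walk-map (λ r → old∈⋃newCover⁺ r)
               (connectedness a p q (old∈⋃newCover⁻ p a∈p) (old∈⋃newCover⁻ q a∈q))
    connect (isFresh a i) a∈p a∈q
      with tag-injective (trans (fresh∈⋃newCover⁻ p a∈p) (sym (fresh∈⋃newCover⁻ q a∈q)))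
    ... | refl = stay a∈p

  newCover-covers : ∀ e → e ∈ E (hypergraphOf withCopies) → ∃ λ p → e S.⊆ ⋃ (newCover p)
  newCover-covers e e∈ =
    let (R , s , s∈) , e≡s = ∈-edges⁻ {A = withCopies} e∈
        p , s⊆p = [ coverOld , coverNew ]′ (∈-++⁻ (map (Vec.map old) (rel B R)) s∈)
    in p , s⊆p ∘ subst (_ S.∈_) e≡s
    where
    coverOld : ∀ {R s} → s ∈ map (Vec.map old) (rel B R) → ∃ λ p → tupleSet s S.⊆ ⋃ (newCover p)
    coverOld s∈old =
      let t , t∈B , s≡t = ∈-map⁻ (Vec.map old) s∈old
          p , t⊆p = edgesCovered (tupleSet t) (∈-edges⁺ {A = B} t∈B)
      in p , λ v∈s →
        let a , a∈t , v≡a = ∈-tupleSet-map⁻ old t (subst (λ s → _ S.∈ tupleSet s) s≡t v∈s) in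
        subst (λ x → x S.∈ ⋃ (newCover p)) (sym v≡a) (old∈⋃newCover⁺ p (t⊆p (∈-tupleSet⁺ a∈t)))

    coverNew : ∀ {R s} → s ∈ fibre Fin._≟_ R newAtoms → ∃ λ p → tupleSet s S.⊆ ⋃ (newCover p)
    coverNew s∈new =
      let p , f , f∈ , Rs≡f = ∈-newAtoms⁻ (∈-fibre⁻ Fin._≟_ newAtoms s∈new) in
      p , λ v∈s → ∈-⋃⁺ (lose (∈-map⁺ (tupleSet ∘ proj₂ ∘ localiseFact p) f∈)
                             (subst (λ x → _ S.∈ tupleSet (proj₂ x)) Rs≡f v∈s))

  withCopies-hasHD : ∀ {j} → WidthIs T j → HasHD (hypergraphOf withCopies) j
  withCopies-hasHD width =
    relabel T newCover ,
    relabel-isHD (hypergraphOf withCopies) T newCover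
                 newCover-connected newCover-covers newCover-edges ,
    relabel-width (hypergraphOf withCopies) T newCover length-newCover width

module _ {σ : Signature} where

  hasGHD⇒equivalent-hasHD : {B : Structure σ} {j : ℕ} → HasGHD (hypergraphOf B) j →
                             ∃ λ (B' : Structure σ) → B' ≡ₛ B × HasHD (hypergraphOf B') j
  hasGHD⇒equivalent-hasHD {B} (T , ghd , width) =
    withCopies , withCopies≡ₛB , withCopies-hasHD width
    where open FreshCopies B T ghd

  EquivalentWidth : (Hypergraph → ℕ → Set) → Structure σ → ℕ → Set
  EquivalentWidth Decomposes A j = ∃ λ (A' : Structure σ) → A' ≡ₛ A × Decomposes (hypergraphOf A') j

  equivalentHD⇔equivalentGHD : (A : Structure σ) (j : ℕ) →
                               EquivalentWidth HasHD A j ⇔ EquivalentWidth HasGHD A j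
  equivalentHD⇔equivalentGHD A j = mk⇔
    (λ { (A' , A'≡A , T , hd , width) → A' , A'≡A , T , IsHD.ghd hd , width })
    (λ { (A' , A'≡A , ghd) → let B , B≡A' , hd = hasGHD⇒equivalent-hasHD ghd in
                             B , ≡ₛ-trans B≡A' A'≡A , hd })

  SemWidth⇔IsMin : (Decomposes : Hypergraph → ℕ → Set) (A : Structure σ) (k : ℕ) →
                   SemWidth (λ H → IsMin (Decomposes H)) A k ⇔ IsMin (EquivalentWidth Decomposes A) k
  SemWidth⇔IsMin Decomposes A k = mk⇔
    (λ { ((A' , A'≡A , dk , _) , k≤minima) →
         (A' , A'≡A , dk) , λ { j (B , B≡A , dj) → ≤-minima⇒≤ (k≤minima B B≡A) j dj } })
    (λ { ((A' , A'≡A , dk) , k≤) →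
         (A' , A'≡A , dk , (λ j dj → k≤ j (A' , A'≡A , dj))) ,
         λ { B B≡A j (dj , _) → k≤ j (B , B≡A , dj) } })

theorem4 : (σ : Signature) (A : Structure σ) (k : ℕ) →
           SemWidth HW A k ⇔ SemWidth GHW A k
theorem4 σ A k =
  ⇔.trans (SemWidth⇔IsMin HasHD A k)
    (⇔.trans (IsMin-⇔ (equivalentHD⇔equivalentGHD A))
             (⇔.sym (SemWidth⇔IsMin HasGHD A k)))
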